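{- Let $f:\mathbb{F}_{2^n}\to\mathbb{F}_{2^n}$, let $\xi\in\mathbb{F}_{2^n}^*$, and suppose $\mathrm{Im}(f)=\{0,\xi\}$. Then $f$ is planar if and only if for all $a\in\mathbb{F}_{2^n}^*$ and all $x\in\mathbb{F}_{2^n}$, $$f(x+a)+f(x)+f\!\left(x+a+\tfrac{\xi}{a}\right)+f\!\left(x+\tfrac{\xi}{a}\right)=0.$$
   Context: $f:\mathbb{F}_{2^n}\to\mathbb{F}_{2^n}$ is planar if for every nonzero $a$, $x\mapsto f(x+a)+f(x)+xa$ is a permutation of $\mathbb{F}_{2^n}$. -}

module Defs where

open import Data.Nat using (ℕ; _^_)
open import Data.Fin using (Fin)
open import Data.Product using (Σ; Σ-syntax; ∃; ∃-syntax; _×_; proj₁)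
open import Data.Sum using (_⊎_)
open import Relation.Binary.PropositionalEquality using (_≡_; _≢_)
open import Function.Bundles using (_↔_)
open import Function.Definitions using (Bijective)
import Algebra.Structures as AS

record GF2^ (n : ℕ) : Set₁ where
  infixl 6 _+_
  infixl 7 _*_
  field
    Carrier : Set
    _+_ _*_ : Carrier → Carrier → Carrier
    -_      : Carrier → Carrier
    0# 1#   : Carrier
    isCommutativeRing : AS.IsCommutativeRing {A = Carrier} _≡_ _+_ _*_ -_ 0# 1#
    0≢1     : 0# ≢ 1#
    inverse : (x : Carrier) → x ≢ 0# → Σ[ y ∈ Carrier ] (x * y ≡ 1#)
    card    : Carrier ↔ Fin (2 ^ n)

  div : Carrier → (a : Carrier) → a ≢ 0# → Carrier
  div x a a≢0 = x * proj₁ (inverse a a≢0)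

module _ {n : ℕ} (F : GF2^ n) where
  open GF2^ F

  Planar : (Carrier → Carrier) → Set
  Planar f = (a : Carrier) → a ≢ 0# →
             Bijective _≡_ _≡_ (λ x → f (x + a) + f x + x * a)

  ImageIs0ξ : (Carrier → Carrier) → Carrier → Set
  ImageIs0ξ f ξ = ((x : Carrier) → (f x ≡ 0#) ⊎ (f x ≡ ξ))
                × (∃[ x ] (f x ≡ 0#))
                × (∃[ x ] (f x ≡ ξ))

  FourPointCondition : (Carrier → Carrier) → Carrier → Set
  FourPointCondition f ξ = (a : Carrier) (a≢0 : a ≢ 0#) (x : Carrier) →
    f (x + a) + f x + f (x + a + div ξ a a≢0) + f (x + div ξ a a≢0) ≡ 0#

-- 𝔽_{2^n} has characteristic 2, so the sum of two values of the derivative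
-- Δₐf(x) = f(x+a) + f(x) + xa at x and y is W + (x+y)a, where
-- W = f(x+a) + f(x) + f(y+a) + f(y) lies in {0, ξ} because Im f does.  So a collision
-- Δₐf(x) = Δₐf(y) with x ≠ y happens exactly when y = x + ξ/a and W = ξ, i.e. when the
-- four-point sum at (a, x) is ξ rather than 0.  Injectivity of Δₐf is bijectivity since
-- the field is finite.
module Submission where

open import Defs
open import Data.Nat using (ℕ; zero; suc; _^_)
import Data.Nat.Properties as ℕ
open import Data.Fin using (Fin; punchOut)
import Data.Fin as Fin
open import Data.Fin.Properties using (any?; punchOut-injective; injective⇒≤; inj⇒≟)
open import Data.Product using (_×_; _,_; proj₁; proj₂)
open import Data.Sum using (_⊎_; inj₁; inj₂)
open import Level using (0ℓ)
open import Algebra.Core using (Op₁; Op₂)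
open import Algebra.Bundles using (AbelianGroup; CommutativeRing)
open import Algebra.Structures using (IsAbelianGroup)
open import Function using (_∘_)
open import Function.Bundles using (_↔_; _⇔_; Inverse; Injection; Equivalence; mk↔ₛ′; mk⇔)
open import Function.Definitions using (Injective; StrictlySurjective; Bijective)
open import Function.Consequences.Propositional using (strictlySurjective⇒surjective)
open import Function.Properties.Inverse using (↔-sym; ↔-trans; ↔⇒↣)
open import Relation.Binary.Definitions using (Decidable)
open import Relation.Nullary using (yes; no; contradiction)
open import Relation.Binary.PropositionalEquality
  using (_≡_; _≢_; refl; sym; trans; cong; module ≡-Reasoning)
open ≡-Reasoning

Fin-injective⇒surjective : ∀ {m} {g : Fin m → Fin m} →
                           Injective _≡_ _≡_ g → StrictlySurjective _≡_ g
Fin-injective⇒surjective {suc k} {g} g-inj y with any? (λ i → g i Fin.≟ y)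
... | yes hit = hit
... | no ¬hit = contradiction (injective⇒≤ avoid-y-injective) ℕ.1+n≰n
  where
  g≢y : ∀ i → y ≢ g i
  g≢y i y≡gi = ¬hit (i , sym y≡gi)

  avoid-y : Fin (suc k) → Fin k
  avoid-y i = punchOut (g≢y i)

  avoid-y-injective : Injective _≡_ _≡_ avoid-y
  avoid-y-injective = g-inj ∘ punchOut-injective (g≢y _) (g≢y _)

finite-injective⇒bijective : ∀ {A : Set} {m} → A ↔ Fin m →
                             {h : A → A} → Injective _≡_ _≡_ h → Bijective _≡_ _≡_ h
finite-injective⇒bijective card {h} h-inj =
  h-inj , strictlySurjective⇒surjective h-strictlySurjective
  where
  open Inverse card using (to; from)

  to-injective : Injective _≡_ _≡_ to
  to-injective = Injection.injective (↔⇒↣ card)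

  from-injective : Injective _≡_ _≡_ from
  from-injective = Injection.injective (↔⇒↣ (↔-sym card))

  h-strictlySurjective : StrictlySurjective _≡_ h
  h-strictlySurjective y =
    let i , e = Fin-injective⇒surjective (from-injective ∘ h-inj ∘ to-injective) (to y)
    in from i , to-injective e

module FiniteAbelianGroup
  {A : Set} {_+_ : Op₂ A} {0# : A} { -_ : Op₁ A }
  (isAbelianGroup : IsAbelianGroup _≡_ _+_ 0# -_) {m : ℕ} (card : A ↔ Fin m) where

  G : AbelianGroup 0ℓ 0ℓ
  G = record { isAbelianGroup = isAbelianGroup }

  open AbelianGroup G using (group; commutativeMonoid; monoid; identityˡ)
  open import Algebra.Properties.Group group using (∙-cancelʳ; \\-leftDividesˡ; \\-leftDividesʳ)
  open import Algebra.Properties.CommutativeMonoid.Sum commutativeMonoid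
    using (sum; sum-permute; sum-cong-≗; ∑-distrib-+; sum-replicate)
  open import Algebra.Properties.Monoid.Mult monoid using () renaming (_×_ to _·_)
  open Inverse card using (to; from; strictlyInverseʳ)

  translation : A → A ↔ A
  translation g = mk↔ₛ′ (g +_) ((- g) +_) (\\-leftDividesˡ g) (\\-leftDividesʳ g)

  -- Summing all elements before and after translating by g.
  card·≡0 : ∀ g → m · g ≡ 0#
  card·≡0 g = ∙-cancelʳ (sum from) (m · g) 0# (begin
    (m · g) + sum from                 ≡⟨ cong (_+ sum from) (sum-replicate m) ⟨
    sum {m} (λ _ → g) + sum from       ≡⟨ ∑-distrib-+ {m} (λ _ → g) from ⟨
    sum (λ i → g + from i)             ≡⟨ sum-cong-≗ (λ i → strictlyInverseʳ (g + from i)) ⟨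
    sum (from ∘ to ∘ (g +_) ∘ from)    ≡⟨ sum-permute from π ⟨
    sum from                           ≡⟨ identityˡ (sum from) ⟨
    0# + sum from                      ∎)
    where π = ↔-trans (↔-sym card) (↔-trans (translation g) card)

module FieldOfOrder2^ {n : ℕ} (F : GF2^ n) where
  open GF2^ F

  ring : CommutativeRing 0ℓ 0ℓ
  ring = record { isCommutativeRing = isCommutativeRing }

  open CommutativeRing ring
    using (+-isAbelianGroup; +-group; semiring; +-identityˡ; +-identityʳ; +-assoc;
           *-assoc; *-comm; *-identityˡ; *-identityʳ; zeroˡ)
  open import Algebra.Properties.Group +-group using (inverseˡ-unique)
  open import Algebra.Properties.Semiring.Mult semiring
    using (×1-homo-*; ×-assoc-*) renaming (_×_ to _·_)
  open FiniteAbelianGroup +-isAbelianGroup card using (card·≡0)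

  _≟_ : Decidable (_≡_ {A = Carrier})
  _≟_ = inj⇒≟ (↔⇒↣ card)

  x/a*a≡x : ∀ x {a} (a≢0 : a ≢ 0#) → div x a a≢0 * a ≡ x
  x/a*a≡x x {a} a≢0 = begin
    (x * a⁻¹) * a  ≡⟨ *-assoc x a⁻¹ a ⟩
    x * (a⁻¹ * a)  ≡⟨ cong (x *_) (*-comm a⁻¹ a) ⟩
    x * (a * a⁻¹)  ≡⟨ cong (x *_) (proj₂ (inverse a a≢0)) ⟩
    x * 1#         ≡⟨ *-identityʳ x ⟩
    x              ∎
    where a⁻¹ = proj₁ (inverse a a≢0)

  x*a≡y⇒x≡y/a : ∀ {x a y} (a≢0 : a ≢ 0#) → x * a ≡ y → x ≡ div y a a≢0
  x*a≡y⇒x≡y/a {x} {a} {y} a≢0 x*a≡y = begin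
    x              ≡⟨ *-identityʳ x ⟨
    x * 1#         ≡⟨ cong (x *_) (proj₂ (inverse a a≢0)) ⟨
    x * (a * a⁻¹)  ≡⟨ *-assoc x a a⁻¹ ⟨
    (x * a) * a⁻¹  ≡⟨ cong (_* a⁻¹) x*a≡y ⟩
    y * a⁻¹        ∎
    where a⁻¹ = proj₁ (inverse a a≢0)

  x*a≡0⇒x≡0 : ∀ {x a} → a ≢ 0# → x * a ≡ 0# → x ≡ 0#
  x*a≡0⇒x≡0 {a = a} a≢0 x*a≡0 =
    trans (x*a≡y⇒x≡y/a a≢0 x*a≡0) (zeroˡ (proj₁ (inverse a a≢0)))

  *-nonzero : ∀ {x y} → x ≢ 0# → y ≢ 0# → x * y ≢ 0#
  *-nonzero x≢0 y≢0 = x≢0 ∘ x*a≡0⇒x≡0 y≢0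

  2^k·1≢0 : 2 · 1# ≢ 0# → ∀ k → (2 ^ k) · 1# ≢ 0#
  2^k·1≢0 2·1≢0 zero    = 0≢1 ∘ sym ∘ trans (sym (+-identityʳ 1#))
  2^k·1≢0 2·1≢0 (suc k) = *-nonzero 2·1≢0 (2^k·1≢0 2·1≢0 k) ∘ trans (sym (×1-homo-* 2 (2 ^ k)))

  -- 2^n · 1 = 0 by card·≡0, whereas 1 + 1 ≢ 0 would make each 2^k · 1 a product of units.
  2·1≡0 : 2 · 1# ≡ 0#
  2·1≡0 with (2 · 1#) ≟ 0#
  ... | yes 2·1≡0 = 2·1≡0
  ... | no  2·1≢0 = contradiction (card·≡0 1#) (2^k·1≢0 2·1≢0 n)

  x+x≡0 : ∀ x → x + x ≡ 0#
  x+x≡0 x = begin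
    x + x          ≡⟨ cong (x +_) (+-identityʳ x) ⟨
    2 · x          ≡⟨ cong (2 ·_) (*-identityˡ x) ⟨
    2 · (1# * x)   ≡⟨ ×-assoc-* 2 1# x ⟨
    (2 · 1#) * x   ≡⟨ cong (_* x) 2·1≡0 ⟩
    0# * x         ≡⟨ zeroˡ x ⟩
    0#             ∎

  x+y≡0⇒x≡y : ∀ {x y} → x + y ≡ 0# → x ≡ y
  x+y≡0⇒x≡y {x} {y} x+y≡0 =
    trans (inverseˡ-unique x y x+y≡0) (sym (inverseˡ-unique y y (x+x≡0 y)))

  x+[x+y]≡y : ∀ x y → x + (x + y) ≡ y
  x+[x+y]≡y x y = begin
    x + (x + y)  ≡⟨ +-assoc x x y ⟨
    (x + x) + y  ≡⟨ cong (_+ y) (x+x≡0 x) ⟩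
    0# + y       ≡⟨ +-identityˡ y ⟩
    y            ∎

module ImageIn0ξ {n : ℕ} (F : GF2^ n) (f : GF2^.Carrier F → GF2^.Carrier F)
  (ξ : GF2^.Carrier F) (ξ≢0 : ξ ≢ GF2^.0# F) (im : ImageIs0ξ F f ξ) where
  open GF2^ F
  open FieldOfOrder2^ F
  open CommutativeRing ring
    using (+-identityˡ; +-identityʳ; zeroˡ; distribʳ; +-commutativeMonoid)
  open import Algebra.Solver.CommutativeMonoid +-commutativeMonoid using (solve; _⊕_; _⊜_)

  _∈0ξ : Carrier → Set
  y ∈0ξ = y ≡ 0# ⊎ y ≡ ξ

  ∈0ξ∧≢ξ⇒≡0 : ∀ {y} → y ∈0ξ → y ≢ ξ → y ≡ 0#
  ∈0ξ∧≢ξ⇒≡0 (inj₁ y≡0) _   = y≡0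
  ∈0ξ∧≢ξ⇒≡0 (inj₂ y≡ξ) y≢ξ = contradiction y≡ξ y≢ξ

  +-∈0ξ : ∀ {u v} → u ∈0ξ → v ∈0ξ → (u + v) ∈0ξ
  +-∈0ξ (inj₁ refl) (inj₁ refl) = inj₁ (+-identityˡ 0#)
  +-∈0ξ (inj₁ refl) (inj₂ refl) = inj₂ (+-identityˡ ξ)
  +-∈0ξ (inj₂ refl) (inj₁ refl) = inj₂ (+-identityʳ ξ)
  +-∈0ξ (inj₂ refl) (inj₂ refl) = inj₁ (x+x≡0 ξ)

  Δ : Carrier → Carrier → Carrier
  Δ a x = f (x + a) + f x + x * a

  fourSum : Carrier → Carrier → Carrier → Carrier
  fourSum a x y = f (x + a) + f x + f (y + a) + f y

  fourSum-∈0ξ : ∀ a x y → fourSum a x y ∈0ξ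
  fourSum-∈0ξ a x y = +-∈0ξ (+-∈0ξ (+-∈0ξ (f∈0ξ (x + a)) (f∈0ξ x)) (f∈0ξ (y + a))) (f∈0ξ y)
    where f∈0ξ = proj₁ im

  fourSum-shift : ∀ a x b → fourSum a x (x + b) ≡ f (x + a) + f x + f (x + a + b) + f (x + b)
  fourSum-shift a x b = cong (λ z → f (x + a) + f x + f z + f (x + b))
    (solve 3 (λ x a b → (x ⊕ b) ⊕ a ⊜ (x ⊕ a) ⊕ b) refl x a b)

  Δ+Δ : ∀ a x y → Δ a x + Δ a y ≡ fourSum a x y + (x + y) * a
  Δ+Δ a x y = begin
    Δ a x + Δ a y                    ≡⟨ solve 6 (λ p q p′ q′ xa ya →
                                        ((p ⊕ q) ⊕ xa) ⊕ ((p′ ⊕ q′) ⊕ ya)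
                                        ⊜ (((p ⊕ q) ⊕ p′) ⊕ q′) ⊕ (xa ⊕ ya))
                                        refl (f (x + a)) (f x) (f (y + a)) (f y) (x * a) (y * a) ⟩
    fourSum a x y + (x * a + y * a)  ≡⟨ cong (fourSum a x y +_) (distribʳ a x y) ⟨
    fourSum a x y + (x + y) * a      ∎

  Δ-collision : ∀ a x y → Δ a x ≡ Δ a y ⇔ (x + y) * a ≡ fourSum a x y
  Δ-collision a x y = mk⇔
    (λ Δx≡Δy → sym (x+y≡0⇒x≡y (trans (sym (Δ+Δ a x y))
                                     (trans (cong (_+ Δ a y) Δx≡Δy) (x+x≡0 (Δ a y))))))
    (λ [x+y]a≡W → x+y≡0⇒x≡y (trans (Δ+Δ a x y)
                                  (trans (cong (fourSum a x y +_) [x+y]a≡W) (x+x≡0 _))))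

  planar⇒fourPoint : Planar F f → FourPointCondition F f ξ
  planar⇒fourPoint planar a a≢0 x =
    trans (sym (fourSum-shift a x b)) (∈0ξ∧≢ξ⇒≡0 (fourSum-∈0ξ a x (x + b)) W≢ξ)
    where
    b = div ξ a a≢0

    W≢ξ : fourSum a x (x + b) ≢ ξ
    W≢ξ W≡ξ = ξ≢0 (begin
      ξ                  ≡⟨ x/a*a≡x ξ a≢0 ⟨
      b * a              ≡⟨ cong (_* a) (x+[x+y]≡y x b) ⟨
      (x + (x + b)) * a  ≡⟨ cong (λ z → (x + z) * a) (proj₁ (planar a a≢0) Δ-collides) ⟨
      (x + x) * a        ≡⟨ cong (_* a) (x+x≡0 x) ⟩
      0# * a             ≡⟨ zeroˡ a ⟩
      0#                 ∎)
      where
      Δ-collides : Δ a x ≡ Δ a (x + b)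
      Δ-collides = Equivalence.from (Δ-collision a x (x + b))
        (trans (cong (_* a) (x+[x+y]≡y x b)) (trans (x/a*a≡x ξ a≢0) (sym W≡ξ)))

  fourPoint⇒Δ-injective : FourPointCondition F f ξ →
                          ∀ a → a ≢ 0# → Injective _≡_ _≡_ (Δ a)
  fourPoint⇒Δ-injective fourPoint a a≢0 {x} {y} Δx≡Δy =
    x+y≡0⇒x≡y (x*a≡0⇒x≡0 a≢0 (trans [x+y]a≡W (∈0ξ∧≢ξ⇒≡0 (fourSum-∈0ξ a x y) W≢ξ)))
    where
    [x+y]a≡W : (x + y) * a ≡ fourSum a x y
    [x+y]a≡W = Equivalence.to (Δ-collision a x y) Δx≡Δy

    W≢ξ : fourSum a x y ≢ ξ
    W≢ξ W≡ξ = ξ≢0 (begin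
      ξ                              ≡⟨ W≡ξ ⟨
      fourSum a x y                  ≡⟨ cong (fourSum a x) y≡x+b ⟩
      fourSum a x (x + div ξ a a≢0)  ≡⟨ fourSum-shift a x (div ξ a a≢0) ⟩
      _                              ≡⟨ fourPoint a a≢0 x ⟩
      0#                             ∎)
      where
      y≡x+b : y ≡ x + div ξ a a≢0
      y≡x+b = trans (sym (x+[x+y]≡y x y))
                    (cong (x +_) (x*a≡y⇒x≡y/a a≢0 (trans [x+y]a≡W W≡ξ)))

lemma4p2 : {n : ℕ} (F : GF2^ n) (f : GF2^.Carrier F → GF2^.Carrier F)
    (ξ : GF2^.Carrier F) → ξ ≢ GF2^.0# F → ImageIs0ξ F f ξ →
    (Planar F f → FourPointCondition F f ξ) × (FourPointCondition F f ξ → Planar F f)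
lemma4p2 F f ξ ξ≢0 im =
  planar⇒fourPoint ,
  λ fourPoint a a≢0 → finite-injective⇒bijective card (fourPoint⇒Δ-injective fourPoint a a≢0)
  where
  open GF2^ F using (card)
  open ImageIn0ξ F f ξ ξ≢0 im
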